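{- Let $p$ be a prime and $n = 2p \ge 3$, and suppose there exists an exponential orthomorphism modulo $n$. Then $p - 1$ is squarefree.
   Context: For an integer $n \ge 2$, an exponential orthomorphism modulo $n$ is a permutation $\sigma$ of $\{1, \dots, n-1\}$ such that the map $x \mapsto x^{\sigma(x)} \bmod n$ is also a bijection of $\{1, \dots, n-1\}$. -}

module Defs where

open import Data.Nat using (ℕ; suc; _+_; _*_; _∸_; _^_; _≡ᵇ_; NonZero)
open import Data.Nat.DivMod using (_%_)
open import Data.Nat.Divisibility using (_∣_)
open import Data.Fin using (Fin; toℕ)
open import Data.Product using (Σ; _×_)
open import Function.Definitions using (Bijective)
open import Relation.Binary.PropositionalEquality using (_≡_)

-- The set {1, …, n-1} is represented by Fin (n ∸ 1): the element i : Fin (n ∸ 1)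
-- stands for the integer toℕ i + 1.
val : {m : ℕ} → Fin m → ℕ
val i = suc (toℕ i)

-- An exponential orthomorphism modulo n: a permutation σ of {1,…,n-1} such that
-- x ↦ x ^ σ(x) mod n is a bijection of {1,…,n-1}.  The latter is expressed by a
-- bijection τ of {1,…,n-1} with τ(x) = x ^ σ(x) mod n for every x (so in particular
-- x ^ σ(x) mod n lies in {1,…,n-1}).
IsExpOrthomorphism : (n : ℕ) .{{_ : NonZero n}} → (Fin (n ∸ 1) → Fin (n ∸ 1)) → Set
IsExpOrthomorphism n σ =
  Bijective _≡_ _≡_ σ ×
  Σ (Fin (n ∸ 1) → Fin (n ∸ 1)) (λ τ →
    Bijective _≡_ _≡_ τ × (∀ x → val (τ x) ≡ (val x ^ val (σ x)) % n))

SquareFree : ℕ → Set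
SquareFree m = ∀ d → d * d ∣ m → d ≡ 1

module Submission where

-- Suppose p - 1 = c·q² with q ≥ 2, and let U_k be the set of x with
-- x^k ≡ 1 (mod p).  Since τ(x)^k ≡ x^(σ(x)·k), τ maps U_k into itself, and being
-- injective on a finite set it also reflects U_k.  If q ∣ σ(x) and x ≠ p, then
-- Fermat's little theorem gives τ(x) ∈ U_(qc), hence x ∈ U_(qc), hence τ(x) ∈ U_c,
-- hence x ∈ U_c.  Now σ is onto and {1, …, 2p-1} contains 2qc multiples of q, so at
-- least 2qc points x have q ∣ σ(x); all of them lie in {p} ∪ U_c.  But by Lagrange's
-- theorem U_c meets at most c residues modulo p, so it has at most 2c elements, and
-- 2qc > 2c + 1.

open import Defs
open import Level using (0ℓ)
open import Data.Nat.Base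
open import Data.Nat.Properties
open import Data.Nat.DivMod
open import Data.Nat.Divisibility
open import Data.Nat.Primality using (Prime; euclidsLemma; prime⇒nonZero; prime⇒nonTrivial)
open import Data.Nat.Solver using (module +-*-Solver)
open import Data.Fin.Base using (Fin; zero; suc; toℕ; fromℕ<; combine)
open import Data.Fin.Properties using (injective⇒≤; toℕ-fromℕ<; toℕ-injective; toℕ<n; combine-injective; any?)
  renaming (suc-injective to Fin-suc-injective; _≟_ to _≟ᶠ_)
open import Data.Fin.Permutation using (Permutation; permutation; _⟨$⟩ʳ_)
open import Data.Vec.Base using (Vec; []; _∷_; replicate)
open import Data.Product.Base using (Σ; ∃; _×_; _,_; proj₁; proj₂)
open import Data.Sum.Base using (inj₁; inj₂; [_,_]; fromInj₁)
open import Data.Empty using (⊥; ⊥-elim)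
open import Data.Unit.Base using (tt)
open import Function.Base using (_∘_; id)
open import Function.Definitions using (Injective; Surjective)
open import Relation.Nullary using (¬_; yes; no; contradiction)
open import Relation.Unary using (Pred; Decidable; _⊆_; _∪_; U)
open import Relation.Unary.Properties using (_∪?_; U?)
open import Relation.Binary.PropositionalEquality
  using (_≡_; _≢_; refl; sym; trans; cong; cong₂; subst; module ≡-Reasoning)
open import Algebra.Properties.CommutativeSemigroup *-commutativeSemigroup using (interchange)
import Algebra.Properties.CommutativeMonoid.Sum as MonoidSum
open MonoidSum *-1-commutativeMonoid using ()
  renaming (sum to ∏; sum-permute to ∏-permute; sum-cong-≗ to ∏-cong)

%-*-cong : ∀ {x x′ y y′} d .{{_ : NonZero d}} →
           x % d ≡ x′ % d → y % d ≡ y′ % d → (x * y) % d ≡ (x′ * y′) % d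
%-*-cong {x} {x′} {y} {y′} d x≡x′ y≡y′ = begin
  (x * y) % d                 ≡⟨ %-distribˡ-* x y d ⟩
  ((x % d) * (y % d)) % d     ≡⟨ cong₂ (λ u v → (u * v) % d) x≡x′ y≡y′ ⟩
  ((x′ % d) * (y′ % d)) % d   ≡⟨ %-distribˡ-* x′ y′ d ⟨
  (x′ * y′) % d               ∎
  where open ≡-Reasoning

%-^-cong : ∀ {x y} d .{{_ : NonZero d}} k → x % d ≡ y % d → (x ^ k) % d ≡ (y ^ k) % d
%-^-cong d zero    _   = refl
%-^-cong d (suc k) x≡y = %-*-cong d x≡y (%-^-cong d k x≡y)

%≡⇒∣∸ : ∀ {m n} d .{{_ : NonZero d}} → n ≤ m → m % d ≡ n % d → d ∣ m ∸ n
%≡⇒∣∸ {m} {n} d _ m≡n = divides (m / d ∸ n / d) (begin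
  m ∸ n                                       ≡⟨ cong₂ _∸_ (m≡m%n+[m/n]*n m d) (m≡m%n+[m/n]*n n d) ⟩
  (m % d + m / d * d) ∸ (n % d + n / d * d)   ≡⟨ cong (λ r → (m % d + m / d * d) ∸ (r + n / d * d)) m≡n ⟨
  (m % d + m / d * d) ∸ (m % d + n / d * d)   ≡⟨ [m+n]∸[m+o]≡n∸o (m % d) _ _ ⟩
  m / d * d ∸ n / d * d                       ≡⟨ *-distribʳ-∸ d (m / d) (n / d) ⟨
  (m / d ∸ n / d) * d                         ∎)
  where open ≡-Reasoning

∣∸⇒%≡ : ∀ {m n} d .{{_ : NonZero d}} → n ≤ m → d ∣ m ∸ n → m % d ≡ n % d
∣∸⇒%≡ {m} {n} d n≤m d∣m∸n = begin
  m % d             ≡⟨ cong (_% d) (m+[n∸m]≡n n≤m) ⟨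
  (n + (m ∸ n)) % d ≡⟨ %-remove-+ʳ n d∣m∸n ⟩
  n % d             ∎
  where open ≡-Reasoning

prime∤* : ∀ {p m n} → Prime p → ¬ p ∣ m → ¬ p ∣ n → ¬ p ∣ m * n
prime∤* pr p∤m p∤n p∣mn = [ p∤m , p∤n ] (euclidsLemma _ _ pr p∣mn)

prime∤1 : ∀ {p} → Prime p → ¬ p ∣ 1
prime∤1 {p} pr = >⇒∤ (nonTrivial⇒n>1 p {{prime⇒nonTrivial pr}})

-- Modulo a prime p, a factor w prime to p can be cancelled: for y ≤ x the prime
-- divides (x ∸ y) * w, hence x ∸ y.
%-*-cancelʳ-≤ : ∀ {p w} .{{_ : NonZero p}} → Prime p → ¬ p ∣ w →
                ∀ {x y} → y ≤ x → (x * w) % p ≡ (y * w) % p → x % p ≡ y % p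
%-*-cancelʳ-≤ {p} {w} pr p∤w {x} {y} y≤x xw≡yw = ∣∸⇒%≡ p y≤x (fromInj₁ (⊥-elim ∘ p∤w)
  (euclidsLemma (x ∸ y) w pr
    (subst (p ∣_) (sym (*-distribʳ-∸ w x y)) (%≡⇒∣∸ p (*-monoˡ-≤ w y≤x) xw≡yw))))

%-*-cancelʳ : ∀ {p w} .{{_ : NonZero p}} → Prime p → ¬ p ∣ w →
              ∀ x y → (x * w) % p ≡ (y * w) % p → x % p ≡ y % p
%-*-cancelʳ pr p∤w x y xw≡yw with ≤-total y x
... | inj₁ y≤x = %-*-cancelʳ-≤ pr p∤w y≤x xw≡yw
... | inj₂ x≤y = sym (%-*-cancelʳ-≤ pr p∤w x≤y (sym xw≡yw))

^≡1-∣ : ∀ {d} .{{_ : NonZero d}} a {k m} → (a ^ k) % d ≡ 1 → k ∣ m → (a ^ m) % d ≡ 1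
^≡1-∣ {d} a {k} aᵏ≡1 (divides t refl) = begin
  (a ^ (t * k)) % d   ≡⟨ cong (λ e → (a ^ e) % d) (*-comm t k) ⟩
  (a ^ (k * t)) % d   ≡⟨ cong (_% d) (^-*-assoc a k t) ⟨
  ((a ^ k) ^ t) % d   ≡⟨ %-^-cong d t (trans aᵏ≡1 (sym 1%d≡1)) ⟩
  (1 ^ t) % d         ≡⟨ cong (_% d) (^-zeroˡ t) ⟩
  1 % d               ≡⟨ 1%d≡1 ⟩
  1                   ∎
  where
  open ≡-Reasoning
  -- The hypothesis forces d > 1.
  1%d≡1 : 1 % d ≡ 1
  1%d≡1 = trans (cong (_% d) (sym aᵏ≡1)) (trans (m%n%n≡m%n (a ^ k) d) aᵏ≡1)

count : ∀ {m} {P : Pred (Fin m) 0ℓ} → Decidable P → ℕ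
count {zero}  P? = 0
count {suc m} P? with P? zero
... | yes _ = suc (count (P? ∘ suc))
... | no  _ = count (P? ∘ suc)

enumerate : ∀ {m} {P : Pred (Fin m) 0ℓ} (P? : Decidable P) → Fin (count P?) → Σ (Fin m) P
enumerate {suc m} P? k with P? zero
enumerate {suc m} P? zero    | yes p₀ = zero , p₀
enumerate {suc m} P? (suc k) | yes _  = let (i , pᵢ) = enumerate (P? ∘ suc) k in suc i , pᵢ
enumerate {suc m} P? k       | no  _  = let (i , pᵢ) = enumerate (P? ∘ suc) k in suc i , pᵢ

enumerate-injective : ∀ {m} {P : Pred (Fin m) 0ℓ} (P? : Decidable P) {k l} →
                      proj₁ (enumerate P? k) ≡ proj₁ (enumerate P? l) → k ≡ l
enumerate-injective {suc m} P? {k} {l} eq with P? zero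
enumerate-injective {suc m} P? {zero}  {zero}  eq | yes _ = refl
enumerate-injective {suc m} P? {suc k} {suc l} eq | yes _ =
  cong suc (enumerate-injective (P? ∘ suc) (Fin-suc-injective eq))
enumerate-injective {suc m} P? {k}     {l}     eq | no  _ =
  enumerate-injective (P? ∘ suc) (Fin-suc-injective eq)

index : ∀ {m} {P : Pred (Fin m) 0ℓ} (P? : Decidable P) i → P i → Fin (count P?)
index {suc m} P? i pᵢ with P? zero
index {suc m} P? zero    pᵢ | yes _  = zero
index {suc m} P? (suc i) pᵢ | yes _  = suc (index (P? ∘ suc) i pᵢ)
index {suc m} P? zero    pᵢ | no ¬p₀ = contradiction pᵢ ¬p₀
index {suc m} P? (suc i) pᵢ | no _   = index (P? ∘ suc) i pᵢ

index-injective : ∀ {m} {P : Pred (Fin m) 0ℓ} (P? : Decidable P) {i j} (pᵢ : P i) (pⱼ : P j) →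
                  index P? i pᵢ ≡ index P? j pⱼ → i ≡ j
index-injective {suc m} P? {i} {j} pᵢ pⱼ eq with P? zero
index-injective {suc m} P? {zero}  {zero}  pᵢ pⱼ eq | yes _  = refl
index-injective {suc m} P? {suc i} {suc j} pᵢ pⱼ eq | yes _  =
  cong suc (index-injective (P? ∘ suc) pᵢ pⱼ (Fin-suc-injective eq))
index-injective {suc m} P? {zero}  {_}     pᵢ pⱼ eq | no ¬p₀ = contradiction pᵢ ¬p₀
index-injective {suc m} P? {suc i} {zero}  pᵢ pⱼ eq | no ¬p₀ = contradiction pⱼ ¬p₀
index-injective {suc m} P? {suc i} {suc j} pᵢ pⱼ eq | no _   =
  cong suc (index-injective (P? ∘ suc) pᵢ pⱼ eq)

module _ {m} {P : Pred (Fin m) 0ℓ} (P? : Decidable P) where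

  count-≤ : ∀ {k} (f : ∀ i → P i → Fin k) →
            (∀ {i j} (pᵢ : P i) (pⱼ : P j) → f i pᵢ ≡ f j pⱼ → i ≡ j) → count P? ≤ k
  count-≤ f f-inj = injective⇒≤ λ {c} {d} eq →
    enumerate-injective P? (f-inj (proj₂ (enumerate P? c)) (proj₂ (enumerate P? d)) eq)

  count-≥ : ∀ {k} (g : Fin k → Fin m) → (∀ c → P (g c)) → Injective _≡_ _≡_ g → k ≤ count P?
  count-≥ g P∘g g-inj = injective⇒≤ (g-inj ∘ index-injective P? (P∘g _) (P∘g _))

  count-empty : (∀ i → ¬ P i) → count P? ≤ 0
  count-empty ¬P = count-≤ (λ i pᵢ → contradiction pᵢ (¬P i)) (λ pᵢ _ _ → contradiction pᵢ (¬P _))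

  count-subsingleton : (∀ {i j} → P i → P j → i ≡ j) → count P? ≤ 1
  count-subsingleton unique = count-≤ (λ _ _ → zero) (λ pᵢ pⱼ _ → unique pᵢ pⱼ)

module _ {m n} {P : Pred (Fin m) 0ℓ} {Q : Pred (Fin n) 0ℓ} (P? : Decidable P) (Q? : Decidable Q) where

  count-↪ : (f : Fin m → Fin n) → (∀ {i} → P i → Q (f i)) →
            (∀ {i j} → P i → P j → f i ≡ f j → i ≡ j) → count P? ≤ count Q?
  count-↪ f P⇒Q f-inj = count-≤ P? (λ i pᵢ → index Q? (f i) (P⇒Q pᵢ))
    (λ pᵢ pⱼ eq → f-inj pᵢ pⱼ (index-injective Q? _ _ eq))

module _ {m} {P Q : Pred (Fin m) 0ℓ} (P? : Decidable P) (Q? : Decidable Q) where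

  count-⊆ : P ⊆ Q → count P? ≤ count Q?
  count-⊆ P⊆Q = count-↪ P? Q? id P⊆Q (λ _ _ → id)

count-∘-surjective : ∀ {m n} {P : Pred (Fin n) 0ℓ} (P? : Decidable P) (f : Fin m → Fin n) →
                     Surjective _≡_ _≡_ f → count P? ≤ count (P? ∘ f)
count-∘-surjective {m} {n} {P} P? f f-surjective =
  count-↪ P? (P? ∘ f) section (λ {y} → subst P (sym (f∘section y)))
    (λ {y} {y′} _ _ eq → trans (sym (f∘section y)) (trans (cong f eq) (f∘section y′)))
  where
  section : Fin n → Fin m
  section y = proj₁ (f-surjective y)
  f∘section : ∀ y → f (section y) ≡ y
  f∘section y = proj₂ (f-surjective y) refl

count-∪ : ∀ {m} {P Q : Pred (Fin m) 0ℓ} (P? : Decidable P) (Q? : Decidable Q) →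
          count (P? ∪? Q?) ≤ count P? + count Q?
count-∪ {zero}  P? Q? = z≤n
count-∪ {suc m} P? Q? with P? zero | Q? zero
... | yes _ | yes _ = s≤s (≤-trans (count-∪ (P? ∘ suc) (Q? ∘ suc)) (+-monoʳ-≤ (count (P? ∘ suc)) (n≤1+n _)))
... | yes _ | no  _ = s≤s (count-∪ (P? ∘ suc) (Q? ∘ suc))
... | no  _ | yes _ = ≤-trans (s≤s (count-∪ (P? ∘ suc) (Q? ∘ suc))) (≤-reflexive (sym (+-suc _ _)))
... | no  _ | no  _ = count-∪ (P? ∘ suc) (Q? ∘ suc)

⊆-saturate : ∀ {m} {P Q : Pred (Fin m) 0ℓ} (P? : Decidable P) (Q? : Decidable Q) →
             P ⊆ Q → count Q? ≤ count P? → Q ⊆ P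
⊆-saturate {suc m} P? Q? P⊆Q Q≤P {i} qᵢ with P? zero | Q? zero
⊆-saturate {suc m} P? Q? P⊆Q Q≤P {zero}  qᵢ | yes p₀ | _      = p₀
⊆-saturate {suc m} P? Q? P⊆Q Q≤P {suc i} qᵢ | yes _  | yes _  =
  ⊆-saturate (P? ∘ suc) (Q? ∘ suc) P⊆Q (s≤s⁻¹ Q≤P) qᵢ
⊆-saturate {suc m} P? Q? P⊆Q Q≤P {i}     qᵢ | yes p₀ | no ¬q₀ = contradiction (P⊆Q p₀) ¬q₀
⊆-saturate {suc m} P? Q? P⊆Q Q≤P {i}     qᵢ | no  _  | yes _  =
  contradiction Q≤P (<⇒≱ (s≤s (count-⊆ (P? ∘ suc) (Q? ∘ suc) P⊆Q)))
⊆-saturate {suc m} P? Q? P⊆Q Q≤P {zero}  qᵢ | no  _  | no ¬q₀ = contradiction qᵢ ¬q₀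
⊆-saturate {suc m} P? Q? P⊆Q Q≤P {suc i} qᵢ | no  _  | no  _  =
  ⊆-saturate (P? ∘ suc) (Q? ∘ suc) P⊆Q Q≤P qᵢ

-- An injective endomap τ of Fin m that maps a decidable set S into itself also
-- reflects S: τ x ∈ S implies x ∈ S.  (S ⊆ τ⁻¹S, and τ⁻¹S is no larger than S.)
injective-reflects : ∀ {m} {S : Pred (Fin m) 0ℓ} (S? : Decidable S) (τ : Fin m → Fin m) →
                     Injective _≡_ _≡_ τ → (∀ {x} → S x → S (τ x)) → ∀ {x} → S (τ x) → S x
injective-reflects S? τ τ-inj τ-preserves =
  ⊆-saturate S? (S? ∘ τ) τ-preserves (count-↪ (S? ∘ τ) S? τ id (λ _ _ → τ-inj))

injective⇒surjective : ∀ {m} (f : Fin m → Fin m) → Injective _≡_ _≡_ f → ∀ y → ∃ λ x → f x ≡ y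
injective⇒surjective {m} f f-inj y = ⊆-saturate image? all? (λ _ → tt) all≤image tt
  where
  image? : Decidable (λ y → ∃ λ x → f x ≡ y)
  image? y = any? (λ x → f x ≟ᶠ y)
  all? : Decidable {A = Fin m} U
  all? = U?
  all≤image : count all? ≤ count image?
  all≤image = ≤-trans (count-≤ all? (λ i _ → i) (λ _ _ → id)) (count-≥ image? f (λ x → x , refl) f-inj)

fromVal : ∀ {N} r .{{_ : NonZero r}} → r ≤ N → Fin N
fromVal (suc r) r<N = fromℕ< r<N

val-fromVal : ∀ {N} r .{{_ : NonZero r}} (r≤N : r ≤ N) → val (fromVal r r≤N) ≡ r
val-fromVal (suc r) r<N = cong suc (toℕ-fromℕ< r<N)

val-injective : ∀ {N} {i j : Fin N} → val i ≡ val j → i ≡ j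
val-injective = toℕ-injective ∘ suc-injective

∏-% : ∀ {d} .{{_ : NonZero d}} {k} (f : Fin k → ℕ) → ∏ (λ i → f i % d) % d ≡ ∏ f % d
∏-% {d} {zero}  f = refl
∏-% {d} {suc k} f = %-*-cong d (m%n%n≡m%n (f zero) d) (∏-% (f ∘ suc))

∏-scale : ∀ a {k} (g : Fin k → ℕ) → ∏ (λ i → a * g i) ≡ a ^ k * ∏ g
∏-scale a {zero}  g = refl
∏-scale a {suc k} g = begin
  a * g zero * ∏ (λ i → a * g (suc i))   ≡⟨ cong (a * g zero *_) (∏-scale a (g ∘ suc)) ⟩
  a * g zero * (a ^ k * ∏ (g ∘ suc))     ≡⟨ interchange a (g zero) (a ^ k) (∏ (g ∘ suc)) ⟩
  a * a ^ k * (g zero * ∏ (g ∘ suc))     ∎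
  where open ≡-Reasoning

prime∤∏ : ∀ {p} → Prime p → ∀ {k} (g : Fin k → ℕ) → (∀ i → ¬ p ∣ g i) → ¬ p ∣ ∏ g
prime∤∏ pr {zero}  g _   = prime∤1 pr
prime∤∏ pr {suc k} g p∤g = prime∤* pr (p∤g zero) (prime∤∏ pr (g ∘ suc) (p∤g ∘ suc))

scaling-permutation : ∀ {N} → Prime (suc N) → ∀ {a} → ¬ suc N ∣ a →
                      Σ (Permutation N N) (λ π → ∀ i → val (π ⟨$⟩ʳ i) ≡ (a * val i) % suc N)
scaling-permutation {N} pr {a} p∤a =
  permutation π (proj₁ ∘ π-surjective) (proj₂ ∘ π-surjective)
    (λ i → π-injective (proj₂ (π-surjective (π i)))) ,
  val-π
  where
  p : ℕ
  p = suc N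

  residue≢0 : ∀ (i : Fin N) → (a * val i) % p ≢ 0
  residue≢0 i r≡0 = prime∤* pr p∤a (>⇒∤ (s≤s (toℕ<n i))) (m%n≡0⇒n∣m _ p r≡0)

  π : Fin N → Fin N
  π i = fromVal ((a * val i) % p) {{≢-nonZero (residue≢0 i)}} (s≤s⁻¹ (m%n<n (a * val i) p))

  val-π : ∀ i → val (π i) ≡ (a * val i) % p
  val-π i = val-fromVal ((a * val i) % p) {{≢-nonZero (residue≢0 i)}} _

  π-injective : Injective _≡_ _≡_ π
  π-injective {i} {j} πi≡πj = val-injective (begin
    val i       ≡⟨ m<n⇒m%n≡m (s≤s (toℕ<n i)) ⟨
    val i % p   ≡⟨ %-*-cancelʳ pr p∤a (val i) (val j) (begin
      (val i * a) % p   ≡⟨ cong (_% p) (*-comm (val i) a) ⟩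
      (a * val i) % p   ≡⟨ val-π i ⟨
      val (π i)         ≡⟨ cong val πi≡πj ⟩
      val (π j)         ≡⟨ val-π j ⟩
      (a * val j) % p   ≡⟨ cong (_% p) (*-comm a (val j)) ⟩
      (val j * a) % p   ∎) ⟩
    val j % p   ≡⟨ m<n⇒m%n≡m (s≤s (toℕ<n j)) ⟩
    val j       ∎)
    where open ≡-Reasoning

  π-surjective : ∀ y → ∃ λ x → π x ≡ y
  π-surjective = injective⇒surjective π π-injective

-- Fermat's little theorem.  With π the permutation i ↦ a·i of the nonzero residues,
-- a^(p-1) · ∏ i ≡ ∏ (a · i) ≡ ∏ π(i) = ∏ i (mod p), and ∏ i is prime to p.
fermat : ∀ {p} .{{_ : NonZero p}} → Prime p → ∀ {a} → ¬ p ∣ a → (a ^ (p ∸ 1)) % p ≡ 1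
fermat {suc N} pr {a} p∤a = begin
  (a ^ N) % p   ≡⟨ %-*-cancelʳ pr p∤∏units (a ^ N) 1 scaled≡unscaled ⟩
  1 % p         ≡⟨ m<n⇒m%n≡m (nonTrivial⇒n>1 p {{prime⇒nonTrivial pr}}) ⟩
  1             ∎
  where
  open ≡-Reasoning
  p : ℕ
  p = suc N

  units : Fin N → ℕ
  units = val

  p∤∏units : ¬ p ∣ ∏ units
  p∤∏units = prime∤∏ pr units (λ i → >⇒∤ (s≤s (toℕ<n i)))

  π : Permutation N N
  π = proj₁ (scaling-permutation pr p∤a)

  scaled≡unscaled : (a ^ N * ∏ units) % p ≡ (1 * ∏ units) % p
  scaled≡unscaled = begin
    (a ^ N * ∏ units) % p                 ≡⟨ cong (_% p) (∏-scale a units) ⟨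
    ∏ (λ i → a * units i) % p             ≡⟨ ∏-% (λ i → a * units i) ⟨
    ∏ (λ i → (a * units i) % p) % p       ≡⟨ cong (_% p) (∏-cong (sym ∘ proj₂ (scaling-permutation pr p∤a))) ⟩
    ∏ (λ i → units (π ⟨$⟩ʳ i)) % p        ≡⟨ cong (_% p) (∏-permute units π) ⟨
    ∏ units % p                           ≡⟨ cong (_% p) (*-identityˡ (∏ units)) ⟨
    (1 * ∏ units) % p                     ∎

-- Monic polynomials with natural coefficients: the vector (a₀, …, aₙ₋₁) of length n
-- stands for a₀ + a₁x + … + aₙ₋₁xⁿ⁻¹ + xⁿ.  Being monic, such a polynomial is never
-- zero modulo p, so the root bound below needs no side condition.
eval : ∀ {n} → Vec ℕ n → ℕ → ℕ
eval []       x = 1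
eval (a ∷ as) x = a + x * eval as x

-- Synthetic division by x - r ("deflation"): the quotient is monic of one degree less.
deflate : ∀ {n} → ℕ → Vec ℕ (suc n) → Vec ℕ n
deflate r (a ∷ [])     = []
deflate r (a ∷ b ∷ bs) = eval (b ∷ bs) r ∷ deflate r (b ∷ bs)

-- f(x) - f(r) = (x - r) · g(x) for g the quotient, written without subtraction.
division-identity : ∀ {n} r (f : Vec ℕ (suc n)) x →
                    eval f x + r * eval (deflate r f) x ≡ x * eval (deflate r f) x + eval f r
division-identity r (a ∷ []) x =
  solve 3 (λ a x r → (a :+ x :* con 1) :+ r :* con 1 := x :* con 1 :+ (a :+ r :* con 1)) refl a x r
  where open +-*-Solver
division-identity r (a ∷ b ∷ bs) x = begin
  (a + x * f₁x) + r * (f₁r + x * g₁x)   ≡⟨ solve 6 (λ a x r f₁x f₁r g₁x →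
                                             (a :+ x :* f₁x) :+ r :* (f₁r :+ x :* g₁x)
                                             := (a :+ r :* f₁r) :+ x :* (f₁x :+ r :* g₁x))
                                             refl a x r f₁x f₁r g₁x ⟩
  (a + r * f₁r) + x * (f₁x + r * g₁x)   ≡⟨ cong (λ t → (a + r * f₁r) + x * t) (division-identity r (b ∷ bs) x) ⟩
  (a + r * f₁r) + x * (x * g₁x + f₁r)   ≡⟨ solve 5 (λ a x r f₁r g₁x →
                                             (a :+ r :* f₁r) :+ x :* (x :* g₁x :+ f₁r)
                                             := x :* (f₁r :+ x :* g₁x) :+ (a :+ r :* f₁r))
                                             refl a x r f₁r g₁x ⟩
  x * (f₁r + x * g₁x) + (a + r * f₁r)   ∎
  where
  open ≡-Reasoning
  open +-*-Solver
  f₁x f₁r g₁x : ℕ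
  f₁x = eval (b ∷ bs) x
  f₁r = eval (b ∷ bs) r
  g₁x = eval (deflate r (b ∷ bs)) x

module Roots {p} (pr : Prime p) where

  instance
    p≢0 : NonZero p
    p≢0 = prime⇒nonZero pr

  Root : ∀ {n} → Vec ℕ n → Pred (Fin p) 0ℓ
  Root f x = p ∣ eval f (toℕ x)

  root? : ∀ {n} (f : Vec ℕ n) → Decidable (Root f)
  root? f x = p ∣? eval f (toℕ x)

  -- If r is a root of f, every other root of f is a root of the quotient by x - r:
  -- otherwise r·g(x) ≡ x·g(x) could be cancelled to give r ≡ x.
  root-of-deflate : ∀ {n} {f : Vec ℕ (suc n)} {r x} → Root f r → Root f x → x ≢ r →
                     Root (deflate (toℕ r) f) x
  root-of-deflate {f = f} {r} {x} root-r root-x x≢r with p ∣? eval (deflate (toℕ r) f) (toℕ x)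
  ... | yes p∣gx = p∣gx
  ... | no  p∤gx = contradiction (toℕ-injective (begin
    toℕ x       ≡⟨ m<n⇒m%n≡m (toℕ<n x) ⟨
    toℕ x % p   ≡⟨ %-*-cancelʳ pr p∤gx (toℕ r) (toℕ x) r·gx≡x·gx ⟨
    toℕ r % p   ≡⟨ m<n⇒m%n≡m (toℕ<n r) ⟩
    toℕ r       ∎)) x≢r
    where
    open ≡-Reasoning
    gx : ℕ
    gx = eval (deflate (toℕ r) f) (toℕ x)
    r·gx≡x·gx : (toℕ r * gx) % p ≡ (toℕ x * gx) % p
    r·gx≡x·gx = begin
      (toℕ r * gx) % p                        ≡⟨ %-remove-+ˡ (toℕ r * gx) root-x ⟨
      (eval f (toℕ x) + toℕ r * gx) % p       ≡⟨ cong (_% p) (division-identity (toℕ r) f (toℕ x)) ⟩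
      (toℕ x * gx + eval f (toℕ r)) % p       ≡⟨ %-remove-+ʳ (toℕ x * gx) root-r ⟩
      (toℕ x * gx) % p                        ∎

  roots-bound : ∀ {n} (f : Vec ℕ n) → count (root? f) ≤ n
  roots-bound [] = count-empty (root? []) (λ _ → prime∤1 pr)
  roots-bound {suc n} (a ∷ as) with any? (root? (a ∷ as))
  ... | no  no-root       = ≤-trans (count-empty (root? (a ∷ as)) (λ x root-x → no-root (x , root-x))) z≤n
  ... | yes (r , root-r)  = begin
    count (root? f)                       ≤⟨ count-⊆ (root? f) ((_≟ᶠ r) ∪? root? g) split ⟩
    count ((_≟ᶠ r) ∪? root? g)            ≤⟨ count-∪ (_≟ᶠ r) (root? g) ⟩
    count (_≟ᶠ r) + count (root? g)       ≤⟨ +-mono-≤ (count-subsingleton (_≟ᶠ r) (λ i≡r j≡r → trans i≡r (sym j≡r)))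
                                                      (roots-bound g) ⟩
    1 + n                                 ∎
    where
    open ≤-Reasoning
    f : Vec ℕ (suc n)
    f = a ∷ as
    g : Vec ℕ n
    g = deflate (toℕ r) f
    split : Root f ⊆ (_≡ r) ∪ Root g
    split {x} root-x with x ≟ᶠ r
    ... | yes x≡r = inj₁ x≡r
    ... | no  x≢r = inj₂ (root-of-deflate {f = f} root-r root-x x≢r)

  -- A k-th root of unity is a root of x^k + (p - 1) ≡ x^k - 1 (mod p), the monic
  -- polynomial with coefficients (p - 1, 0, …, 0).
  unity-poly : ∀ k → Vec ℕ (suc k)
  unity-poly k = (p ∸ 1) ∷ replicate k 0

  eval-replicate : ∀ k x → eval (replicate k 0) x ≡ x ^ k
  eval-replicate zero    x = refl
  eval-replicate (suc k) x = cong (x *_) (eval-replicate k x)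

  unity⇒root : ∀ k → (λ x → (toℕ x ^ suc k) % p ≡ 1) ⊆ Root (unity-poly k)
  unity⇒root k {x} xᵏ⁺¹≡1 = divides (suc (y / p)) (begin
    (p ∸ 1) + toℕ x * eval (replicate k 0) (toℕ x)  ≡⟨ cong (λ t → (p ∸ 1) + toℕ x * t) (eval-replicate k (toℕ x)) ⟩
    (p ∸ 1) + y                                   ≡⟨ cong ((p ∸ 1) +_) (m≡m%n+[m/n]*n y p) ⟩
    (p ∸ 1) + (y % p + y / p * p)                 ≡⟨ cong (λ t → (p ∸ 1) + (t + y / p * p)) xᵏ⁺¹≡1 ⟩
    (p ∸ 1) + (1 + y / p * p)                     ≡⟨ +-assoc (p ∸ 1) 1 (y / p * p) ⟨
    (p ∸ 1 + 1) + y / p * p                       ≡⟨ cong (_+ y / p * p) (m∸n+n≡m (>-nonZero⁻¹ p)) ⟩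
    p + y / p * p                                 ∎)
    where
    open ≡-Reasoning
    y : ℕ
    y = toℕ x ^ suc k

  unity-roots-bound : ∀ k .{{_ : NonZero k}} → count (λ (x : Fin p) → (toℕ x ^ k) % p ≟ 1) ≤ k
  unity-roots-bound (suc k) = ≤-trans (count-⊆ _ (root? (unity-poly k)) (λ {x} → unity⇒root k {x}))
                                      (roots-bound (unity-poly k))

residue : ∀ {M} p .{{_ : NonZero p}} → Fin M → Fin p
residue p y = fromℕ< (m%n<n (val y) p)

-- If M < k·p, each residue modulo p has at most k representatives among 1, …, M:
-- an integer is determined by its remainder and its quotient, which is below k.
count-residues : ∀ {M} p .{{_ : NonZero p}} {k} → M < k * p →
                 {R : Pred (Fin p) 0ℓ} (R? : Decidable R) → count (R? ∘ residue {M} p) ≤ count R? * k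
count-residues {M} p {k} M<kp {R} R? = count-≤ (R? ∘ residue p) label label-injective
  where
  quotient< : (y : Fin M) → val y / p < k
  quotient< y = m<n*o⇒m/o<n (≤-<-trans (toℕ<n y) M<kp)

  label : ∀ y → R (residue p y) → Fin (count R? * k)
  label y r = combine (index R? (residue p y) r) (fromℕ< (quotient< y))

  label-injective : ∀ {y y′} r r′ → label y r ≡ label y′ r′ → y ≡ y′
  label-injective {y} {y′} r r′ eq = val-injective (begin
    val y                         ≡⟨ m≡m%n+[m/n]*n (val y) p ⟩
    val y % p + val y / p * p     ≡⟨ cong₂ (λ a b → a + b * p) same-remainder same-quotient ⟩
    val y′ % p + val y′ / p * p   ≡⟨ m≡m%n+[m/n]*n (val y′) p ⟨
    val y′                        ∎)
    where
    open ≡-Reasoning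
    same-pair : index R? (residue p y) r ≡ index R? (residue p y′) r′ ×
                fromℕ< (quotient< y) ≡ fromℕ< (quotient< y′)
    same-pair = combine-injective _ _ _ _ eq
    same-remainder : val y % p ≡ val y′ % p
    same-remainder = begin
      val y % p                  ≡⟨ toℕ-fromℕ< _ ⟨
      toℕ (residue p y)          ≡⟨ cong toℕ (index-injective R? r r′ (proj₁ same-pair)) ⟩
      toℕ (residue p y′)         ≡⟨ toℕ-fromℕ< _ ⟩
      val y′ % p                 ∎
    same-quotient : val y / p ≡ val y′ / p
    same-quotient = begin
      val y / p                          ≡⟨ toℕ-fromℕ< _ ⟨
      toℕ (fromℕ< (quotient< y))         ≡⟨ cong toℕ (proj₂ same-pair) ⟩
      toℕ (fromℕ< (quotient< y′))        ≡⟨ toℕ-fromℕ< _ ⟩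
      val y′ / p                         ∎

multiples-bound : ∀ {M} q .{{_ : NonZero q}} L → q * L ≤ M →
                  L ≤ count (λ (v : Fin M) → q ∣? val v)
multiples-bound {M} q L qL≤M = count-≥ _ multiple is-multiple multiple-injective
  where
  multiple : Fin L → Fin M
  multiple i = fromVal (q * val i) {{m*n≢0 q (val i)}} (≤-trans (*-monoʳ-≤ q (toℕ<n i)) qL≤M)

  val-multiple : ∀ i → val (multiple i) ≡ q * val i
  val-multiple i = val-fromVal (q * val i) {{m*n≢0 q (val i)}} _

  is-multiple : ∀ i → q ∣ val (multiple i)
  is-multiple i = subst (q ∣_) (sym (val-multiple i)) (m∣m*n (val i))

  multiple-injective : Injective _≡_ _≡_ multiple
  multiple-injective {i} {j} eq = val-injective (*-cancelˡ-≡ (val i) (val j) q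
    (trans (sym (val-multiple i)) (trans (cong val eq) (val-multiple j))))

2qc>2c+1 : ∀ {q} c .{{_ : NonZero c}} → 2 ≤ q → suc (c * 2) < 2 * (q * c)
2qc>2c+1 {q} c@(suc c′) 2≤q = begin-strict
  suc (c * 2)       <⟨ s≤s (s≤s (m≤n+m (c * 2) (c′ * 2))) ⟩
  c * 2 + c * 2     ≡⟨ solve 1 (λ c → c :* con 2 :+ c :* con 2 := con 2 :* (con 2 :* c)) refl c ⟩
  2 * (2 * c)       ≤⟨ *-monoʳ-≤ 2 (*-monoˡ-≤ c 2≤q) ⟩
  2 * (q * c)       ∎
  where
  open ≤-Reasoning
  open +-*-Solver

module ExponentialOrthomorphism {p} (pr : Prime p)
  (σ τ : Fin (2 * p ∸ 1) → Fin (2 * p ∸ 1))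
  (σ-surjective : Surjective _≡_ _≡_ σ) (τ-injective : Injective _≡_ _≡_ τ)
  .{{_ : NonZero (2 * p)}}
  (τ≡x^σ : ∀ x → val (τ x) ≡ (val x ^ val (σ x)) % (2 * p)) where

  open Roots pr using (p≢0; unity-roots-bound)

  M : ℕ
  M = 2 * p ∸ 1

  M<2p : M < 2 * p
  M<2p = ∸-monoʳ-< {2 * p} (s≤s z≤n) (>-nonZero⁻¹ (2 * p))

  multiple-of-p : ∀ x → p ∣ val x → val x ≡ p
  multiple-of-p x (divides (suc zero)    x≡p)  = trans x≡p (+-identityʳ p)
  multiple-of-p x (divides (suc (suc t)) x≡tp) = contradiction (≤-trans 2p≤x (toℕ<n x)) (<⇒≱ M<2p)
    where
    2p≤x : 2 * p ≤ val x
    2p≤x = subst (2 * p ≤_) (sym x≡tp) (+-monoʳ-≤ p (+-monoʳ-≤ p z≤n))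

  Unity : ℕ → Pred (Fin M) 0ℓ
  Unity k y = (val y ^ k) % p ≡ 1

  unity? : ∀ k → Decidable (Unity k)
  unity? k y = (val y ^ k) % p ≟ 1

  -- Since p ∣ 2p, powers of τ(x) are powers of x modulo p.
  τ-power : ∀ x k → (val (τ x) ^ k) % p ≡ (val x ^ (val (σ x) * k)) % p
  τ-power x k = begin
    (val (τ x) ^ k) % p               ≡⟨ %-^-cong p k τx≡x^σ ⟩
    ((val x ^ val (σ x)) ^ k) % p     ≡⟨ cong (_% p) (^-*-assoc (val x) (val (σ x)) k) ⟩
    (val x ^ (val (σ x) * k)) % p     ∎
    where
    open ≡-Reasoning
    τx≡x^σ : val (τ x) % p ≡ (val x ^ val (σ x)) % p
    τx≡x^σ = trans (cong (_% p) (τ≡x^σ x)) (m∣n⇒o%n%m≡o%m p (2 * p) _ (n∣m*n 2))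

  τ-preserves-unity : ∀ k {x} → Unity k x → Unity k (τ x)
  τ-preserves-unity k {x} xᵏ≡1 = trans (τ-power x k) (^≡1-∣ {p} (val x) {k} xᵏ≡1 (n∣m*n (val (σ x))))

  τ-reflects-unity : ∀ k {x} → Unity k (τ x) → Unity k x
  τ-reflects-unity k = injective-reflects (unity? k) τ τ-injective (τ-preserves-unity k)

  module _ (q c : ℕ) .{{_ : NonZero q}} .{{_ : NonZero c}} (p-1≡cq² : p ∸ 1 ≡ c * (q * q)) where
    open +-*-Solver

    -- If q divides σ(x) and x ≠ p, then x^c ≡ 1 (mod p).  Writing σ(x) = tq,
    -- Fermat gives τ(x)^(qc) ≡ x^(t(p-1)) ≡ 1, so x^(qc) ≡ 1; then
    -- τ(x)^c ≡ x^(t·qc) ≡ 1, so x^c ≡ 1.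
    q∣σ⇒unity : ∀ x → val x ≢ p → q ∣ val (σ x) → Unity c x
    q∣σ⇒unity x x≢p (divides t σx≡tq) = τ-reflects-unity c
      (trans (τ-power x c) (^≡1-∣ {p} (val x) x^qc≡1 (divides t σx·c≡t·qc)))
      where
      x^p-1≡1 : Unity (p ∸ 1) x
      x^p-1≡1 = fermat pr (x≢p ∘ multiple-of-p x)
      σx·qc≡t·[p-1] : val (σ x) * (q * c) ≡ t * (p ∸ 1)
      σx·qc≡t·[p-1] = begin
        val (σ x) * (q * c)  ≡⟨ cong (_* (q * c)) σx≡tq ⟩
        t * q * (q * c)      ≡⟨ solve 3 (λ t q c → t :* q :* (q :* c) := t :* (c :* (q :* q))) refl t q c ⟩
        t * (c * (q * q))    ≡⟨ cong (t *_) p-1≡cq² ⟨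
        t * (p ∸ 1)          ∎
        where open ≡-Reasoning
      σx·c≡t·qc : val (σ x) * c ≡ t * (q * c)
      σx·c≡t·qc = trans (cong (_* c) σx≡tq) (*-assoc t q c)
      x^qc≡1 : Unity (q * c) x
      x^qc≡1 = τ-reflects-unity (q * c)
        (trans (τ-power x (q * c)) (^≡1-∣ {p} (val x) x^p-1≡1 (divides t σx·qc≡t·[p-1])))

    q∣σ⇒p∨unity : (λ x → q ∣ val (σ x)) ⊆ (λ x → val x ≡ p) ∪ Unity c
    q∣σ⇒p∨unity {x} q∣σx with val x ≟ p
    ... | yes x≡p = inj₁ x≡p
    ... | no  x≢p = inj₂ (q∣σ⇒unity x x≢p q∣σx)

    -- At most 2c of 1, …, 2p-1 are c-th roots of unity: at most c residues, each
    -- with at most two representatives.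
    unity-count : count (unity? c) ≤ c * 2
    unity-count = begin
      count (unity? c)                         ≤⟨ count-⊆ (unity? c) (residue-unity? ∘ residue {M} p) to-residue ⟩
      count (residue-unity? ∘ residue {M} p)   ≤⟨ count-residues p M<2p residue-unity? ⟩
      count residue-unity? * 2                 ≤⟨ *-monoˡ-≤ 2 (unity-roots-bound c) ⟩
      c * 2                                    ∎
      where
      open ≤-Reasoning
      residue-unity? : Decidable (λ (r : Fin p) → (toℕ r ^ c) % p ≡ 1)
      residue-unity? r = (toℕ r ^ c) % p ≟ 1
      to-residue : Unity c ⊆ (λ y → (toℕ (residue p y) ^ c) % p ≡ 1)
      to-residue {y} yᶜ≡1 = trans (%-^-cong p c residue≡y) yᶜ≡1
        where
        residue≡y : toℕ (residue {M} p y) % p ≡ val y % p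
        residue≡y = trans (cong (_% p) (toℕ-fromℕ< _)) (m%n%n≡m%n (val y) p)

    -- On the other hand 1, …, 2p-1 contain 2qc multiples of q, and σ is onto.
    exponent-count : 2 * (q * c) ≤ suc (c * 2)
    exponent-count = begin
      2 * (q * c)                      ≤⟨ multiples-bound q (2 * (q * c)) q·2qc≤M ⟩
      count multiple?                  ≤⟨ count-∘-surjective multiple? σ σ-surjective ⟩
      count (multiple? ∘ σ)            ≤⟨ count-⊆ (multiple? ∘ σ) (is-p? ∪? unity? c) q∣σ⇒p∨unity ⟩
      count (is-p? ∪? unity? c)        ≤⟨ count-∪ is-p? (unity? c) ⟩
      count is-p? + count (unity? c)   ≤⟨ +-mono-≤ (count-subsingleton is-p? (λ i≡p j≡p → val-injective (trans i≡p (sym j≡p))))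
                                                    unity-count ⟩
      suc (c * 2)                      ∎
      where
      open ≤-Reasoning
      multiple? : Decidable (λ (v : Fin M) → q ∣ val v)
      multiple? v = q ∣? val v
      is-p? : Decidable (λ (x : Fin M) → val x ≡ p)
      is-p? x = val x ≟ p
      q·2qc≤M : q * (2 * (q * c)) ≤ M
      q·2qc≤M = begin
        q * (2 * (q * c))   ≡⟨ solve 2 (λ q c → q :* (con 2 :* (q :* c)) := con 2 :* (c :* (q :* q))) refl q c ⟩
        2 * (c * (q * q))   ≡⟨ cong (2 *_) p-1≡cq² ⟨
        2 * (p ∸ 1)         ≡⟨ *-distribˡ-∸ 2 p 1 ⟩
        2 * p ∸ 2           ≤⟨ ∸-monoʳ-≤ (2 * p) (s≤s z≤n) ⟩
        M                   ∎

    no-square-factor : 2 ≤ q → ⊥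
    no-square-factor 2≤q = <⇒≱ (2qc>2c+1 c 2≤q) exponent-count

  p-1≢0 : p ∸ 1 ≢ 0
  p-1≢0 = m>n⇒m∸n≢0 (nonTrivial⇒n>1 p {{prime⇒nonTrivial pr}})

  square-free : SquareFree (p ∸ 1)
  square-free zero            0∣p-1                    = contradiction (0∣⇒≡0 0∣p-1) p-1≢0
  square-free (suc zero)      _                        = refl
  square-free (suc (suc _))   (divides zero p-1≡0)     = contradiction p-1≡0 p-1≢0
  square-free q@(suc (suc _)) (divides c@(suc _) p-1≡cq²) =
    ⊥-elim (no-square-factor q c p-1≡cq² (s≤s (s≤s z≤n)))

proposition3p5 : (p : ℕ) → (pr : Prime p) → 3 ≤ 2 * p →
    Σ (Fin (2 * p ∸ 1) → Fin (2 * p ∸ 1))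
      (λ σ → IsExpOrthomorphism (2 * p) {{m*n≢0 2 p {{_}} {{prime⇒nonZero pr}}}} σ) →
    SquareFree (p ∸ 1)
proposition3p5 p pr _ (σ , (_ , σ-surjective) , τ , (τ-injective , _) , τ≡x^σ) =
  ExponentialOrthomorphism.square-free pr σ τ σ-surjective τ-injective
    {{m*n≢0 2 p {{_}} {{prime⇒nonZero pr}}}} τ≡x^σ
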